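{- Let $d\ge 2$ and let $X=X_d$ be a finite nonempty set of labels (so every internal vertex of a tree in $\mathcal{LT}(X)$ has exactly $d$ children). Then for every integer $k\ge 0$, $$|\mathcal{LT}_{kd-k+1}(X)|=|X_d|^k\,\frac{(kd)!}{(d!)^k\cdot k!}.$$
   Context: Let $X=\bigsqcup_{n\ge2}X_n$ be a finite alphabet written as a disjoint union of subsets $X_n$; "$X=X_d$" means $X_n=\emptyset$ for $n\neq d$. A planar $X$-labelled rooted tree is a planar rooted tree (the children of each vertex are totally ordered, left to right) in which no internal vertex has exactly one child, each internal vertex with $m$ children is labelled by an element of $X_m$, and the leaves are labelled bijectively by $\{1,\dots,l\}$, where $l$ is the number of leaves, subject to the local increasing condition: if each internal vertex is temporarily assigned the smallest label of a leaf descending from it, then for every internal vertex the integers assigned to its children increase from left to right. $\mathcal{LT}_l(X)$ denotes the set of such trees with $l$ leaves (the one-vertex tree is the unique element with $l=1$). -}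

module Defs where

open import Data.Nat using (ℕ; zero; suc; _+_; _*_; _∸_; _^_; _≤ᵇ_; _<ᵇ_; _≡ᵇ_; _⊓_)
open import Data.Bool using (Bool; true; false; _∧_; if_then_else_)
open import Data.Fin using (Fin)
open import Data.Vec using (Vec; []; _∷_)
open import Data.List using (List; []; _∷_; _++_; length)
open import Data.Bool.ListAction using (any; all)
open import Data.Product using (Σ)
open import Relation.Binary.PropositionalEquality using (_≡_)

-- A finite graded alphabet X = ⊔_n X_n is given by the sizes x n = |X_n|;
-- the labels of arity n are Fin (x n).

data Tree (x : ℕ → ℕ) : Set where
  leaf : ℕ → Tree x
  node : (n : ℕ) → Fin (x n) → Vec (Tree x) n → Tree x

module _ {x : ℕ → ℕ} where
  mutual
    leaves : Tree x → List ℕ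
    leaves (leaf i) = i ∷ []
    leaves (node n a ts) = leavesV ts

    leavesV : ∀ {n} → Vec (Tree x) n → List ℕ
    leavesV [] = []
    leavesV (t ∷ ts) = leaves t ++ leavesV ts

  -- minimum of a list (only applied to nonempty lists of leaf labels)
  minList : List ℕ → ℕ
  minList [] = 0
  minList (i ∷ []) = i
  minList (i ∷ j ∷ is) = i ⊓ minList (j ∷ is)

  minLeaf : Tree x → ℕ
  minLeaf t = minList (leaves t)

  increasingV : ∀ {n} → Vec (Tree x) n → Bool
  increasingV [] = true
  increasingV (t ∷ []) = true
  increasingV (t ∷ u ∷ ts) = (minLeaf t <ᵇ minLeaf u) ∧ increasingV (u ∷ ts)

  mutual
    wellFormed : Tree x → Bool
    wellFormed (leaf i) = true
    wellFormed (node n a ts) = (2 ≤ᵇ n) ∧ increasingV ts ∧ wellFormedV ts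

    wellFormedV : ∀ {n} → Vec (Tree x) n → Bool
    wellFormedV [] = true
    wellFormedV (t ∷ ts) = wellFormed t ∧ wellFormedV ts

  oneTo : ℕ → List ℕ
  oneTo zero = []
  oneTo (suc l) = oneTo l ++ (suc l ∷ [])

  leavesBijective : ℕ → Tree x → Bool
  leavesBijective l t =
    (length (leaves t) ≡ᵇ l) ∧ all (λ i → any (λ j → i ≡ᵇ j) (leaves t)) (oneTo l)

  isLT : ℕ → Tree x → Bool
  isLT l t = wellFormed t ∧ leavesBijective l t

LT : (x : ℕ → ℕ) → ℕ → Set
LT x l = Σ (Tree x) (λ t → isLT l t ≡ true)

concentrated : ℕ → ℕ → (ℕ → ℕ)
concentrated d m n = if n ≡ᵇ d then m else 0

module Submission where

-- Generalise from trees to increasing forests: vectors of j trees, ordered by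
-- their smallest leaves, whose leaves carry the labels a, ..., a + n - 1. The
-- smallest label a lies in the first tree. Either that tree is the leaf a, which
-- is simply removed, or it is an internal vertex, which is replaced by its d
-- children: the first child stays in front and the other d - 1 are shuffled
-- into the remaining trees in order of their smallest leaves. Writing F(i, j)
-- for the number of forests with i internal vertices and j trees, this gives
--   F(i, j + 1) = F(i, j) + |X_d| · C(j + d - 1, d - 1) · F(i - 1, j + d),
-- whose solution is F(i, j + 1) · j! · i! · (d!)^i = |X_d|^i · (i d + j)!.
-- A single tree with k internal vertices is the case j = 0.

open import Defs
open import Axiom.UniquenessOfIdentityProofs using (module Decidable⇒UIP)
open import Data.Bool using (true; false; T; _∧_; if_then_else_)
import Data.Bool.Properties as Bool
open import Data.Bool.ListAction using (any; all)
open import Data.Empty using (⊥; ⊥-elim)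
import Data.Empty.Irrelevant as Irrelevant
open import Data.Fin as Fin using (Fin)
open import Data.Fin.Properties using (+↔⊎; *↔×)
open import Data.List using (List; []; _∷_; _++_; length)
open import Data.List.Membership.Propositional using (_∈_)
open import Data.List.Membership.Propositional.Properties using (∈-++⁺ˡ; ∈-++⁺ʳ; ∈-++⁻; ∈-∃++)
open import Data.List.Properties using (++-assoc; ++-identityʳ; length-++)
open import Data.List.Relation.Binary.Disjoint.Propositional using (Disjoint)
open import Data.List.Relation.Binary.Permutation.Propositional
  using (_↭_; ↭-refl; ↭-sym; ↭-trans; ↭-prep; ↭-reflexive; ↭⇒↭ₛ)
open import Data.List.Relation.Binary.Permutation.Propositional.Properties
  using (∈-resp-↭; ↭-length; ++⁺ˡ; shift; shifts; drop-∷)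
import Data.List.Relation.Binary.Permutation.Setoid.Properties as ↭ₛ
open import Data.List.Relation.Binary.Subset.Propositional using (_⊆_)
open import Data.List.Relation.Unary.All as ListAll using ([]; _∷_)
open import Data.List.Relation.Unary.All.Properties as ListAllₚ using (all⁺; all⁻)
open import Data.List.Relation.Unary.Any as Any using (here; there)
open import Data.List.Relation.Unary.Any.Properties using (any⁺; any⁻)
open import Data.List.Relation.Unary.AllPairs using ([]; _∷_)
open import Data.List.Relation.Unary.Unique.Propositional using (Unique)
open import Data.Nat using (ℕ; zero; suc; _+_; _*_; _∸_; _^_; _!; _≤_; _<_; _<ᵇ_; _≡ᵇ_; z≤n; s≤s; s≤s⁻¹; z<s)
open import Data.Nat.Properties
open import Data.Nat.Tactic.RingSolver using (solve-∀)
open import Data.Product as Product using (Σ; _×_; _,_; proj₁; proj₂; ∃)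
open import Data.Product.Function.NonDependent.Propositional using (_×-↔_)
open import Data.Sum using (_⊎_; inj₁; inj₂)
open import Data.Sum.Function.Propositional using (_⊎-↔_)
open import Data.Vec using (Vec; []; _∷_)
open import Data.Vec.Relation.Unary.All as All using (All; []; _∷_)
open import Data.Vec.Relation.Unary.AllPairs as AllPairs using (AllPairs; []; _∷_; allPairs?)
open import Function using (_∘_; _⇔_; Equivalence; mk⇔)
open import Function.Bundles using (_↔_; mk↔ₛ′)
open import Function.Properties.Inverse using (↔-refl; ↔-sym; ↔-trans)
open import Relation.Binary.PropositionalEquality
open import Relation.Nullary using (yes; no; contradiction)
open import Relation.Nullary.Decidable using (recompute)

private variable
  A : Set
  a b c j n : ℕ

∧-trueˡ : ∀ {x y} → x ∧ y ≡ true → x ≡ true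
∧-trueˡ {true} _ = refl

∧-trueʳ : ∀ {x y} → x ∧ y ≡ true → y ≡ true
∧-trueʳ {true} p = p

∧-true : ∀ {x y} → x ≡ true → y ≡ true → x ∧ y ≡ true
∧-true refl p = p

<ᵇ≡true⇒< : ∀ {x y} → (x <ᵇ y) ≡ true → x < y
<ᵇ≡true⇒< = <ᵇ⇒< _ _ ∘ Equivalence.from Bool.T-≡

<⇒<ᵇ≡true : ∀ {x y} → x < y → (x <ᵇ y) ≡ true
<⇒<ᵇ≡true = Equivalence.to Bool.T-≡ ∘ <⇒<ᵇ

empty↔Fin0 : (A → ⊥) → A ↔ Fin 0
empty↔Fin0 ¬a = mk↔ₛ′ (⊥-elim ∘ ¬a) (λ ()) (λ ()) (⊥-elim ∘ ¬a)

module _ {x : ℕ → ℕ} where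

  minList-≤ : ∀ {y} xs → y ∈ xs → minList {x} xs ≤ y
  minList-≤ (z ∷ [])     (here refl) = ≤-refl
  minList-≤ (z ∷ w ∷ zs) (here refl) = m⊓n≤m z (minList {x} (w ∷ zs))
  minList-≤ (z ∷ w ∷ zs) (there y∈) =
    ≤-trans (m⊓n≤n z (minList {x} (w ∷ zs))) (minList-≤ (w ∷ zs) y∈)

  minList-∈ : ∀ {y} xs → y ∈ xs → minList {x} xs ∈ xs
  minList-∈ (z ∷ zs) _ = minList-∈-∷ z zs
    where
    minList-∈-∷ : ∀ z zs → minList {x} (z ∷ zs) ∈ z ∷ zs
    minList-∈-∷ z []       = here refl
    minList-∈-∷ z (w ∷ zs) with z ≤? minList {x} (w ∷ zs)
    ... | yes z≤ = here (m≤n⇒m⊓n≡m z≤)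
    ... | no  z≰ = there (subst (_∈ w ∷ zs) (sym (m≥n⇒m⊓n≡n (≰⇒≥ z≰))) (minList-∈-∷ w zs))

  minList-≡ : ∀ {y} xs → y ∈ xs → ListAll.All (y ≤_) xs → minList {x} xs ≡ y
  minList-≡ xs y∈ y≤ = ≤-antisym (minList-≤ xs y∈) (ListAll.lookup y≤ (minList-∈ xs y∈))

range : ℕ → ℕ → List ℕ
range a zero    = []
range a (suc n) = a ∷ range (suc a) n

range-≥ : ∀ {y} → y ∈ range a n → a ≤ y
range-≥ {n = suc n} (here refl) = ≤-refl
range-≥ {n = suc n} (there y∈)  = <⇒≤ (range-≥ y∈)

range-length : ∀ a n → length (range a n) ≡ n
range-length a zero    = refl
range-length a (suc n) = cong suc (range-length (suc a) n)

range-unique : ∀ a n → Unique (range a n)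
range-unique a zero    = []
range-unique a (suc n) =
  ListAll.tabulate (λ y∈ a≡y → <-irrefl a≡y (range-≥ y∈)) ∷ range-unique (suc a) n

range-snoc : ∀ a n → range a (suc n) ≡ range a n ++ a + n ∷ []
range-snoc a zero    = cong (_∷ []) (sym (+-identityʳ a))
range-snoc a (suc n) = cong (a ∷_) (trans (range-snoc (suc a) n)
                                           (cong (λ z → range (suc a) n ++ z ∷ []) (sym (+-suc a n))))

oneTo≡range : ∀ {x} l → oneTo {x} l ≡ range 1 l
oneTo≡range zero    = refl
oneTo≡range {x} (suc l) = trans (cong (_++ suc l ∷ []) (oneTo≡range {x} l)) (sym (range-snoc 1 l))

Unique-resp-↭ : {xs ys : List ℕ} → xs ↭ ys → Unique xs → Unique ys
Unique-resp-↭ = ↭ₛ.Unique-resp-↭ (setoid ℕ) ∘ ↭⇒↭ₛ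

Unique-++⇒Disjoint : ∀ (xs : List ℕ) {ys} → Unique (xs ++ ys) → Disjoint xs ys
Unique-++⇒Disjoint (x ∷ xs) (x∉ ∷ _)  (here refl , x∈ys) = ListAll.lookup x∉ (∈-++⁺ʳ xs x∈ys) refl
Unique-++⇒Disjoint (x ∷ xs) (_ ∷ uniq) (there y∈xs , y∈ys) = Unique-++⇒Disjoint xs uniq (y∈xs , y∈ys)

∈-++-∷⁻ : ∀ (xs : List ℕ) {ys y z} → z ∈ xs ++ y ∷ ys → z ≢ y → z ∈ xs ++ ys
∈-++-∷⁻ []       (here z≡y) z≢y = ⊥-elim (z≢y z≡y)
∈-++-∷⁻ []       (there z∈) _   = z∈
∈-++-∷⁻ (x ∷ xs) (here z≡x) _   = here z≡x
∈-++-∷⁻ (x ∷ xs) (there z∈) z≢y = there (∈-++-∷⁻ xs z∈ z≢y)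

⊆-length⇒↭ : ∀ (xs ys : List ℕ) → Unique ys → length xs ≤ length ys → ys ⊆ xs → xs ↭ ys
⊆-length⇒↭ []       []       _ _  _ = ↭-refl
⊆-length⇒↭ (_ ∷ _)  []       _ () _
⊆-length⇒↭ xs       (y ∷ ys) (y∉ ∷ uniq) len ys⊆ with ∈-∃++ (ys⊆ (here refl))
... | xs₁ , xs₂ , refl =
  ↭-trans (shift y xs₁ xs₂) (↭-prep y (⊆-length⇒↭ (xs₁ ++ xs₂) ys uniq len′ ys⊆′))
  where
  len′ : length (xs₁ ++ xs₂) ≤ length ys
  len′ = s≤s⁻¹ (subst (_≤ suc (length ys)) (↭-length (shift y xs₁ xs₂)) len)
  ys⊆′ : ys ⊆ xs₁ ++ xs₂
  ys⊆′ z∈ = ∈-++-∷⁻ xs₁ (ys⊆ (there z∈)) (λ z≡y → ListAll.lookup y∉ z∈ (sym z≡y))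

leavesBijective⇔↭ : ∀ {x} l (t : Tree x) → T (leavesBijective l t) ⇔ (leaves t ↭ range 1 l)
leavesBijective⇔↭ {x} l t = mk⇔ to from
  where
  to : T (leavesBijective l t) → leaves t ↭ range 1 l
  to bij with Equivalence.to Bool.T-∧ bij
  ... | len , covers = ⊆-length⇒↭ (leaves t) (range 1 l) (range-unique 1 l)
    (≤-reflexive (trans (≡ᵇ⇒≡ _ _ len) (sym (range-length 1 l))))
    (λ {y} y∈ → Any.map (λ {k} → ≡ᵇ⇒≡ y k) (any⁻ _ (leaves t)
      (ListAll.lookup (all⁺ _ (oneTo {x} l) covers) (subst (y ∈_) (sym (oneTo≡range {x} l)) y∈))))
  from : leaves t ↭ range 1 l → T (leavesBijective l t)
  from p = Equivalence.from Bool.T-∧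
    ( ≡⇒≡ᵇ _ _ (trans (↭-length p) (range-length 1 l))
    , all⁻ _ (ListAll.tabulate λ {y} y∈ → any⁺ _
        (Any.map (λ {k} → ≡⇒≡ᵇ y k) (∈-resp-↭ (↭-sym p) (subst (y ∈_) (oneTo≡range {x} l) y∈)))))

-- Shuffles

data Shuffle : ℕ → ℕ → ℕ → Set where
  []    : Shuffle 0 0 0
  left  : Shuffle b c n → Shuffle (suc b) c (suc n)
  right : Shuffle b c n → Shuffle b (suc c) (suc n)

merge : Shuffle b c n → Vec A b → Vec A c → Vec A n
merge []        []       []       = []
merge (left σ)  (x ∷ xs) ys       = x ∷ merge σ xs ys
merge (right σ) xs       (y ∷ ys) = y ∷ merge σ xs ys

unmergeˡ : Shuffle b c n → Vec A n → Vec A b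
unmergeˡ []        []       = []
unmergeˡ (left σ)  (z ∷ zs) = z ∷ unmergeˡ σ zs
unmergeˡ (right σ) (z ∷ zs) = unmergeˡ σ zs

unmergeʳ : Shuffle b c n → Vec A n → Vec A c
unmergeʳ []        []       = []
unmergeʳ (left σ)  (z ∷ zs) = unmergeʳ σ zs
unmergeʳ (right σ) (z ∷ zs) = z ∷ unmergeʳ σ zs

unmergeˡ-merge : ∀ (σ : Shuffle b c n) (xs : Vec A b) ys → unmergeˡ σ (merge σ xs ys) ≡ xs
unmergeˡ-merge []        []       []       = refl
unmergeˡ-merge (left σ)  (x ∷ xs) ys       = cong (x ∷_) (unmergeˡ-merge σ xs ys)
unmergeˡ-merge (right σ) xs       (y ∷ ys) = unmergeˡ-merge σ xs ys

unmergeʳ-merge : ∀ (σ : Shuffle b c n) (xs : Vec A b) ys → unmergeʳ σ (merge σ xs ys) ≡ ys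
unmergeʳ-merge []        []       []       = refl
unmergeʳ-merge (left σ)  (x ∷ xs) ys       = unmergeʳ-merge σ xs ys
unmergeʳ-merge (right σ) xs       (y ∷ ys) = cong (y ∷_) (unmergeʳ-merge σ xs ys)

merge-unmerge : ∀ (σ : Shuffle b c n) (zs : Vec A n) → merge σ (unmergeˡ σ zs) (unmergeʳ σ zs) ≡ zs
merge-unmerge []        []       = refl
merge-unmerge (left σ)  (z ∷ zs) = cong (z ∷_) (merge-unmerge σ zs)
merge-unmerge (right σ) (z ∷ zs) = cong (z ∷_) (merge-unmerge σ zs)

module _ {P : A → Set} where

  All-merge⁺ : ∀ (σ : Shuffle b c n) {xs ys} → All P xs → All P ys → All P (merge σ xs ys)
  All-merge⁺ []        []         []         = []
  All-merge⁺ (left σ)  (px ∷ pxs) pys        = px ∷ All-merge⁺ σ pxs pys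
  All-merge⁺ (right σ) pxs        (py ∷ pys) = py ∷ All-merge⁺ σ pxs pys

  All-merge⁻ : ∀ (σ : Shuffle b c n) xs ys → All P (merge σ xs ys) → All P xs × All P ys
  All-merge⁻ []        []       []       []         = [] , []
  All-merge⁻ (left σ)  (x ∷ xs) ys       (px ∷ pzs) = Product.map₁ (px ∷_) (All-merge⁻ σ xs ys pzs)
  All-merge⁻ (right σ) xs       (y ∷ ys) (py ∷ pzs) = Product.map₂ (py ∷_) (All-merge⁻ σ xs ys pzs)

  All-unmergeˡ : ∀ (σ : Shuffle b c n) {zs} → All P zs → All P (unmergeˡ σ zs)
  All-unmergeˡ []        []         = []
  All-unmergeˡ (left σ)  (pz ∷ pzs) = pz ∷ All-unmergeˡ σ pzs
  All-unmergeˡ (right σ) (pz ∷ pzs) = All-unmergeˡ σ pzs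

  All-unmergeʳ : ∀ (σ : Shuffle b c n) {zs} → All P zs → All P (unmergeʳ σ zs)
  All-unmergeʳ []        []         = []
  All-unmergeʳ (left σ)  (pz ∷ pzs) = All-unmergeʳ σ pzs
  All-unmergeʳ (right σ) (pz ∷ pzs) = pz ∷ All-unmergeʳ σ pzs

module _ {R : A → A → Set} where

  AllPairs-unmergeˡ : ∀ (σ : Shuffle b c n) {zs} → AllPairs R zs → AllPairs R (unmergeˡ σ zs)
  AllPairs-unmergeˡ []        []           = []
  AllPairs-unmergeˡ (left σ)  (rz ∷ rzs) = All-unmergeˡ σ rz ∷ AllPairs-unmergeˡ σ rzs
  AllPairs-unmergeˡ (right σ) (_  ∷ rzs) = AllPairs-unmergeˡ σ rzs

  AllPairs-unmergeʳ : ∀ (σ : Shuffle b c n) {zs} → AllPairs R zs → AllPairs R (unmergeʳ σ zs)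
  AllPairs-unmergeʳ []        []           = []
  AllPairs-unmergeʳ (left σ)  (_  ∷ rzs) = AllPairs-unmergeʳ σ rzs
  AllPairs-unmergeʳ (right σ) (rz ∷ rzs) = All-unmergeʳ σ rz ∷ AllPairs-unmergeʳ σ rzs

shuffles : ℕ → ℕ → ℕ → ℕ
shuffles zero    zero    zero    = 1
shuffles (suc b) zero    (suc n) = shuffles b zero n
shuffles zero    (suc c) (suc n) = shuffles zero c n
shuffles (suc b) (suc c) (suc n) = shuffles b (suc c) n + shuffles (suc b) c n
shuffles _       _       _       = 0

Shuffle↔Fin : ∀ b c n → Shuffle b c n ↔ Fin (shuffles b c n)
Shuffle↔Fin zero zero zero =
  mk↔ₛ′ (λ _ → Fin.zero) (λ _ → []) (λ { Fin.zero → refl ; (Fin.suc ()) }) (λ { [] → refl })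
Shuffle↔Fin (suc b) zero (suc n) =
  ↔-trans (mk↔ₛ′ (λ { (left σ) → σ }) left (λ _ → refl) (λ { (left σ) → refl })) (Shuffle↔Fin b zero n)
Shuffle↔Fin zero (suc c) (suc n) =
  ↔-trans (mk↔ₛ′ (λ { (right σ) → σ }) right (λ _ → refl) (λ { (right σ) → refl })) (Shuffle↔Fin zero c n)
Shuffle↔Fin (suc b) (suc c) (suc n) =
  ↔-trans split (↔-trans (Shuffle↔Fin b (suc c) n ⊎-↔ Shuffle↔Fin (suc b) c n) (↔-sym +↔⊎))
  where
  split : Shuffle (suc b) (suc c) (suc n) ↔ (Shuffle b (suc c) n ⊎ Shuffle (suc b) c n)
  split = mk↔ₛ′ (λ { (left σ) → inj₁ σ ; (right σ) → inj₂ σ })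
                (λ { (inj₁ σ) → left σ ; (inj₂ σ) → right σ })
                (λ { (inj₁ σ) → refl ; (inj₂ σ) → refl })
                (λ { (left σ) → refl ; (right σ) → refl })
Shuffle↔Fin zero    zero    (suc n) = empty↔Fin0 (λ ())
Shuffle↔Fin (suc b) zero    zero    = empty↔Fin0 (λ ())
Shuffle↔Fin zero    (suc c) zero    = empty↔Fin0 (λ ())
Shuffle↔Fin (suc b) (suc c) zero    = empty↔Fin0 (λ ())

shuffles-binomial : ∀ b c n → b + c ≡ n → shuffles b c n * (b ! * c !) ≡ n !
shuffles-binomial zero zero zero _ = refl
shuffles-binomial (suc b) zero (suc n) eq = begin
    shuffles b zero n * (suc b * b ! * 1)   ≡⟨ pullʳ (shuffles b zero n) (suc b) (b !) 1 ⟩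
    suc b * (shuffles b zero n * (b ! * 1)) ≡⟨ cong₂ _*_ (trans (sym (+-identityʳ (suc b))) eq)
                                                          (shuffles-binomial b zero n (suc-injective eq)) ⟩
    suc n * n !                             ∎
  where
  open ≡-Reasoning
  pullʳ : ∀ x y z u → x * (y * z * u) ≡ y * (x * (z * u))
  pullʳ = solve-∀
shuffles-binomial zero (suc c) (suc n) eq = begin
    shuffles zero c n * (1 * (suc c * c !)) ≡⟨ pullˡ (shuffles zero c n) (suc c) (c !) 1 ⟩
    suc c * (shuffles zero c n * (1 * c !)) ≡⟨ cong₂ _*_ eq (shuffles-binomial zero c n (suc-injective eq)) ⟩
    suc n * n !                             ∎
  where
  open ≡-Reasoning
  pullˡ : ∀ x y z u → x * (u * (y * z)) ≡ y * (x * (u * z))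
  pullˡ = solve-∀
shuffles-binomial (suc b) (suc c) (suc n) eq = begin
    (s₁ + s₂) * (suc b * b ! * (suc c * c !))
      ≡⟨ split s₁ s₂ (suc b) (b !) (suc c) (c !) ⟩
    suc b * (s₁ * (b ! * (suc c * c !))) + suc c * (s₂ * (suc b * b ! * c !))
      ≡⟨ cong₂ (λ x y → suc b * x + suc c * y)
               (shuffles-binomial b (suc c) n (suc-injective eq))
               (shuffles-binomial (suc b) c n (trans (sym (+-suc b c)) (suc-injective eq))) ⟩
    suc b * n ! + suc c * n !
      ≡⟨ *-distribʳ-+ (n !) (suc b) (suc c) ⟨
    (suc b + suc c) * n !
      ≡⟨ cong (_* n !) eq ⟩
    suc n * n !
      ∎
  where
  open ≡-Reasoning
  s₁ = shuffles b (suc c) n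
  s₂ = shuffles (suc b) c n
  split : ∀ x y p q r t → (x + y) * (p * q * (r * t)) ≡ p * (x * (q * (r * t))) + r * (y * (p * q * t))
  split = solve-∀

module _ (key : A → ℕ) where

  Sorted : Vec A n → Set
  Sorted = AllPairs (λ x y → key x < key y)

  Distinct : Vec A b → Vec A c → Set
  Distinct xs ys = All (λ x → All (λ y → key x ≢ key y) ys) xs

  sortingShuffle : Vec A b → Vec A c → b + c ≡ n → Shuffle b c n
  sortingShuffle {n = zero}  []       []       _  = []
  sortingShuffle {n = suc n} []       (y ∷ ys) eq = right (sortingShuffle [] ys (suc-injective eq))
  sortingShuffle {n = suc n} (x ∷ xs) []       eq = left (sortingShuffle xs [] (suc-injective eq))
  sortingShuffle {n = suc n} (x ∷ xs) (y ∷ ys) eq with key x <? key y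
  ... | yes _ = left (sortingShuffle xs (y ∷ ys) (suc-injective eq))
  ... | no  _ = right (sortingShuffle (x ∷ xs) ys (trans (sym (+-suc _ _)) (suc-injective eq)))

  sortingShuffle-sorted : ∀ (xs : Vec A b) (ys : Vec A c) (eq : b + c ≡ n) →
    Sorted xs → Sorted ys → Distinct xs ys → Sorted (merge (sortingShuffle xs ys eq) xs ys)
  sortingShuffle-sorted {n = zero} [] [] _ _ _ _ = []
  sortingShuffle-sorted {n = suc n} [] (y ∷ ys) _ _ (y< ∷ sys) _ =
    All-merge⁺ (sortingShuffle [] ys _) [] y< ∷ sortingShuffle-sorted [] ys _ [] sys []
  sortingShuffle-sorted {n = suc n} (x ∷ xs) [] _ (x< ∷ sxs) _ (_ ∷ dxs) =
    All-merge⁺ (sortingShuffle xs [] _) x< [] ∷ sortingShuffle-sorted xs [] _ sxs [] dxs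
  sortingShuffle-sorted {n = suc n} (x ∷ xs) (y ∷ ys) _ (x< ∷ sxs) (y< ∷ sys) (dx ∷ dxs)
    with key x <? key y
  ... | yes x<y =
    All-merge⁺ (sortingShuffle xs (y ∷ ys) _) x< (x<y ∷ All.map (<-trans x<y) y<)
      ∷ sortingShuffle-sorted xs (y ∷ ys) _ sxs (y< ∷ sys) dxs
  ... | no x≮y =
    All-merge⁺ (sortingShuffle (x ∷ xs) ys _) (y<x ∷ All.map (<-trans y<x) x<) y<
      ∷ sortingShuffle-sorted (x ∷ xs) ys _ (x< ∷ sxs) sys (All.map All.tail (dx ∷ dxs))
    where
    y<x : key y < key x
    y<x = ≤∧≢⇒< (≮⇒≥ x≮y) (λ y≡x → All.head dx (sym y≡x))

  sortingShuffle-unique : ∀ (σ : Shuffle b c n) xs ys (eq : b + c ≡ n) →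
    Sorted (merge σ xs ys) → sortingShuffle xs ys eq ≡ σ
  sortingShuffle-unique [] [] [] _ _ = refl
  sortingShuffle-unique (left σ) (x ∷ xs) [] _ (_ ∷ s) =
    cong left (sortingShuffle-unique σ xs [] _ s)
  sortingShuffle-unique (left σ) (x ∷ xs) (y ∷ ys) _ (x< ∷ s) with key x <? key y
  ... | yes _   = cong left (sortingShuffle-unique σ xs (y ∷ ys) _ s)
  ... | no x≮y = contradiction (All.head (proj₂ (All-merge⁻ σ xs (y ∷ ys) x<))) x≮y
  sortingShuffle-unique (right σ) [] (y ∷ ys) _ (_ ∷ s) =
    cong right (sortingShuffle-unique σ [] ys _ s)
  sortingShuffle-unique (right σ) (x ∷ xs) (y ∷ ys) _ (y< ∷ s) with key x <? key y
  ... | yes x<y = contradiction (All.head (proj₁ (All-merge⁻ σ (x ∷ xs) ys y<))) (<-asym x<y)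
  ... | no _    = cong right (sortingShuffle-unique σ (x ∷ xs) ys _ s)

-- The counting recurrence

module Counting (e m : ℕ) where

  d : ℕ
  d = suc (suc e)

  -- forestCount i j is the F(i, j) above, and unfoldedCount i j counts the
  -- forests among them whose first tree is not a leaf.
  mutual
    forestCount : ℕ → ℕ → ℕ
    forestCount i       (suc j) = forestCount i j + unfoldedCount i j
    forestCount zero    zero    = 1
    forestCount (suc i) zero    = 0

    unfoldedCount : ℕ → ℕ → ℕ
    unfoldedCount zero    j = 0
    unfoldedCount (suc i) j = m * (shuffles (suc e) j (suc e + j) * forestCount i (suc (suc e + j)))

  forestCount-zero : ∀ j → forestCount 0 j ≡ 1
  forestCount-zero zero    = refl
  forestCount-zero (suc j) = trans (+-identityʳ (forestCount 0 j)) (forestCount-zero j)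

  ClosedForm : ℕ → ℕ → Set
  ClosedForm i j = forestCount i (suc j) * (j ! * (i ! * (d !) ^ i)) ≡ m ^ i * (i * d + j) !

  closedForm-zero : ∀ j → ClosedForm 0 j
  closedForm-zero j = begin
    forestCount 0 (suc j) * (j ! * 1) ≡⟨ cong (_* (j ! * 1)) (forestCount-zero (suc j)) ⟩
    1 * (j ! * 1)                     ≡⟨ cong (1 *_) (*-identityʳ (j !)) ⟩
    1 * j !                           ∎
    where open ≡-Reasoning

  private
    pull : ∀ x y z → x * (y * z) ≡ y * (x * z)
    pull = solve-∀

  module _ (i j : ℕ) where
    private
      W = (suc i) ! * (d !) ^ suc i
      L = i * d + (suc e + j)
      M = m ^ suc i * L !

    closedForm-step : forestCount (suc i) j * (j ! * W) ≡ j * M →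
                      unfoldedCount (suc i) j * (j ! * W) ≡ suc i * d * M →
                      ClosedForm (suc i) j
    closedForm-step shorter unfolded = begin
        forestCount (suc i) (suc j) * (j ! * W)
          ≡⟨ *-distribʳ-+ (j ! * W) (forestCount (suc i) j) (unfoldedCount (suc i) j) ⟩
        forestCount (suc i) j * (j ! * W) + unfoldedCount (suc i) j * (j ! * W)
          ≡⟨ cong₂ _+_ shorter unfolded ⟩
        j * M + suc i * d * M
          ≡⟨ *-distribʳ-+ M j (suc i * d) ⟨
        (j + suc i * d) * M
          ≡⟨ cong (_* M) j+[1+i]d≡1+L ⟩
        suc L * M
          ≡⟨ pull (suc L) (m ^ suc i) (L !) ⟩
        m ^ suc i * (suc L) !
          ≡⟨ cong (λ k → m ^ suc i * k !) (trans (+-comm (suc i * d) j) j+[1+i]d≡1+L) ⟨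
        m ^ suc i * (suc i * d + j) !
          ∎
      where
      open ≡-Reasoning
      j+[1+i]d≡1+L : j + suc i * d ≡ suc L
      j+[1+i]d≡1+L = lemma i j e
        where lemma : ∀ i j e → j + suc i * suc (suc e) ≡ suc (i * suc (suc e) + (suc e + j))
              lemma = solve-∀

    shorterForests : ClosedForm (suc i) j →
      forestCount (suc i) (suc j) * (suc j ! * W) ≡ suc j * (m ^ suc i * (i * d + (suc e + suc j)) !)
    shorterForests closed = begin
        forestCount (suc i) (suc j) * (suc j * j ! * W)
          ≡⟨ regroup (forestCount (suc i) (suc j)) (suc j) (j !) W ⟩
        suc j * (forestCount (suc i) (suc j) * (j ! * W))
          ≡⟨ cong (suc j *_) closed ⟩
        suc j * (m ^ suc i * (suc i * d + j) !)
          ≡⟨ cong (λ k → suc j * (m ^ suc i * k !)) [1+i]d+j≡id+[1+e+[1+j]] ⟩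
        suc j * (m ^ suc i * (i * d + (suc e + suc j)) !)
          ∎
      where
      open ≡-Reasoning
      regroup : ∀ x y z w → x * (y * z * w) ≡ y * (x * (z * w))
      regroup = solve-∀
      [1+i]d+j≡id+[1+e+[1+j]] : suc i * d + j ≡ i * d + (suc e + suc j)
      [1+i]d+j≡id+[1+e+[1+j]] = lemma i j e
        where lemma : ∀ i j e → suc i * suc (suc e) + j ≡ i * suc (suc e) + (suc e + suc j)
              lemma = solve-∀

    unfoldedForests : ClosedForm i (suc e + j) → unfoldedCount (suc i) j * (j ! * W) ≡ suc i * d * M
    unfoldedForests closed = begin
        m * (S * F) * (j ! * (suc i * i ! * (d * suc e ! * (d !) ^ i)))
          ≡⟨ regroup m S F (j !) i (i !) e (suc e !) ((d !) ^ i) ⟩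
        suc i * d * m * (F * (S * (suc e ! * j !) * (i ! * (d !) ^ i)))
          ≡⟨ cong (λ k → suc i * d * m * (F * (k * (i ! * (d !) ^ i))))
                  (shuffles-binomial (suc e) j (suc e + j) refl) ⟩
        suc i * d * m * (F * ((suc e + j) ! * (i ! * (d !) ^ i)))
          ≡⟨ cong (suc i * d * m *_) closed ⟩
        suc i * d * m * (m ^ i * L !)
          ≡⟨ *-assoc (suc i * d) m (m ^ i * L !) ⟩
        suc i * d * (m * (m ^ i * L !))
          ≡⟨ cong (suc i * d *_) (*-assoc m (m ^ i) (L !)) ⟨
        suc i * d * M
          ∎
      where
      open ≡-Reasoning
      S = shuffles (suc e) j (suc e + j)
      F = forestCount i (suc (suc e + j))
      regroup : ∀ m S F J i I e E D →
        m * (S * F) * (J * (suc i * I * (suc (suc e) * E * D))) ≡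
        suc i * suc (suc e) * m * (F * (S * (E * J) * (I * D)))
      regroup = solve-∀

  closedForm : ∀ i j → ClosedForm i j
  closedForm zero    j       = closedForm-zero j
  closedForm (suc i) zero    =
    closedForm-step i zero refl (unfoldedForests i zero (closedForm i (suc e + zero)))
  closedForm (suc i) (suc j) =
    closedForm-step i (suc j) (shorterForests i j (closedForm (suc i) j))
                              (unfoldedForests i (suc j) (closedForm i (suc e + suc j)))

  forestCount-one : ∀ k → forestCount k 1 * ((d !) ^ k * k !) ≡ m ^ k * (k * d) !
  forestCount-one k = begin
    forestCount k 1 * ((d !) ^ k * k !)       ≡⟨ cong (forestCount k 1 *_) (*-comm ((d !) ^ k) (k !)) ⟩
    forestCount k 1 * (k ! * (d !) ^ k)       ≡⟨ cong (forestCount k 1 *_) (*-identityˡ _) ⟨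
    forestCount k 1 * (1 * (k ! * (d !) ^ k)) ≡⟨ closedForm k 0 ⟩
    m ^ k * (k * d + 0) !                     ≡⟨ cong (λ n → m ^ k * n !) (+-identityʳ (k * d)) ⟩
    m ^ k * (k * d) !                         ∎
    where open ≡-Reasoning

-- Increasing forests of d-ary trees

module DAryForests (e m : ℕ) where
  open Counting e m using (d; forestCount; unfoldedCount)

  X : ℕ → ℕ
  X = concentrated d m

  DTree : Set
  DTree = Tree X

  arity : ∀ {k} → Fin (X k) → k ≡ d
  arity {k} ℓ with k ≡ᵇ d in eq
  ... | true  = ≡ᵇ⇒≡ k d (Equivalence.from Bool.T-≡ eq)
  arity {k} () | false

  Fin-Xd↔Fin-m : Fin (X d) ↔ Fin m
  Fin-Xd↔Fin-m = subst (λ k → Fin (X d) ↔ Fin k) Xd≡m ↔-refl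
    where
    Xd≡m : X d ≡ m
    Xd≡m = cong (λ b → if b then m else 0) (Equivalence.to Bool.T-≡ (≡⇒≡ᵇ d d refl))

  key : DTree → ℕ
  key = minLeaf

  Increasing : Vec DTree n → Set
  Increasing = Sorted key

  WellFormed : DTree → Set
  WellFormed t = wellFormed t ≡ true

  leaves-nonempty : ∀ (t : DTree) → ∃ (_∈ leaves t)
  leaves-nonempty (leaf i)      = i , here refl
  leaves-nonempty (node k ℓ cs) = helper k ℓ cs (arity ℓ)
    where
    helper : ∀ k (ℓ : Fin (X k)) cs → k ≡ d → ∃ (_∈ leaves (node k ℓ cs))
    helper _ _ (c ∷ _) refl = let y , y∈ = leaves-nonempty c in y , ∈-++⁺ˡ y∈

  key∈leaves : ∀ (t : DTree) → key t ∈ leaves t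
  key∈leaves t = minList-∈ {X} (leaves t) (proj₂ (leaves-nonempty t))

  key≤ : ∀ (t : DTree) {y} → y ∈ leaves t → key t ≤ y
  key≤ t = minList-≤ {X} (leaves t)

  key∈leavesV : ∀ (ts : Vec DTree n) → All (λ t → key t ∈ leavesV ts) ts
  key∈leavesV []       = []
  key∈leavesV (t ∷ ts) = ∈-++⁺ˡ (key∈leaves t) ∷ All.map (∈-++⁺ʳ (leaves t)) (key∈leavesV ts)

  <keys⇒<leavesV : ∀ {k} {ts : Vec DTree n} → All (λ t → k < key t) ts → ListAll.All (k <_) (leavesV ts)
  <keys⇒<leavesV []           = []
  <keys⇒<leavesV {ts = t ∷ _} (k<t ∷ k<ts) =
    ListAllₚ.++⁺ (ListAll.tabulate (λ y∈ → <-≤-trans k<t (key≤ t y∈))) (<keys⇒<leavesV k<ts)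

  labels≤keys : ∀ {ts : Vec DTree n} → leavesV ts ↭ range a b → All (λ t → a ≤ key t) ts
  labels≤keys {ts = ts} p = All.map (λ k∈ → range-≥ (∈-resp-↭ p k∈)) (key∈leavesV ts)

  key-node : ∀ (ℓ : Fin (X (suc n))) c (cs : Vec DTree n) →
             Increasing (c ∷ cs) → key (node (suc n) ℓ (c ∷ cs)) ≡ key c
  key-node _ c _ (c< ∷ _) = minList-≡ {X} _ (∈-++⁺ˡ (key∈leaves c))
    (ListAllₚ.++⁺ (ListAll.tabulate (key≤ c)) (ListAll.map <⇒≤ (<keys⇒<leavesV c<)))

  min∈head : ∀ t (ts : Vec DTree n) → Increasing (t ∷ ts) → leavesV (t ∷ ts) ↭ range a (suc b) → a ∈ leaves t
  min∈head {a = a} t ts (t< ∷ _) p with ∈-++⁻ (leaves t) (∈-resp-↭ (↭-sym p) (here refl))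
  ... | inj₁ a∈t  = a∈t
  ... | inj₂ a∈ts = contradiction (ListAll.lookup (<keys⇒<leavesV t<) a∈ts) (≤⇒≯ a≤key)
    where
    a≤key : a ≤ key t
    a≤key = range-≥ (∈-resp-↭ p (∈-++⁺ˡ (key∈leaves t)))

  leavesV-merge : ∀ (σ : Shuffle b c n) (xs : Vec DTree b) ys →
                  leavesV (merge σ xs ys) ↭ leavesV xs ++ leavesV ys
  leavesV-merge []        []       []       = ↭-refl
  leavesV-merge (left σ)  (x ∷ xs) ys       =
    ↭-trans (++⁺ˡ (leaves x) (leavesV-merge σ xs ys)) (↭-reflexive (sym (++-assoc (leaves x) _ _)))
  leavesV-merge (right σ) xs       (y ∷ ys) =
    ↭-trans (++⁺ˡ (leaves y) (leavesV-merge σ xs ys)) (shifts (leaves y) (leavesV xs))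

  leavesV-unfold : ∀ ℓ c (cs : Vec DTree (suc e)) (rest : Vec DTree j) (σ : Shuffle (suc e) j n) →
    leavesV (c ∷ merge σ cs rest) ↭ leavesV (node d ℓ (c ∷ cs) ∷ rest)
  leavesV-unfold ℓ c cs rest σ =
    ↭-trans (++⁺ˡ (leaves c) (leavesV-merge σ cs rest)) (↭-reflexive (sym (++-assoc (leaves c) _ _)))

  wellFormedV⇒All : ∀ (ts : Vec DTree n) → wellFormedV ts ≡ true → All WellFormed ts
  wellFormedV⇒All []       _  = []
  wellFormedV⇒All (t ∷ ts) wf = ∧-trueˡ wf ∷ wellFormedV⇒All ts (∧-trueʳ wf)

  All⇒wellFormedV : ∀ {ts : Vec DTree n} → All WellFormed ts → wellFormedV ts ≡ true
  All⇒wellFormedV []         = refl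
  All⇒wellFormedV (wf ∷ wfs) = ∧-true wf (All⇒wellFormedV wfs)

  increasingV⇒Increasing : ∀ (ts : Vec DTree n) → increasingV ts ≡ true → Increasing ts
  increasingV⇒Increasing []           _   = []
  increasingV⇒Increasing (t ∷ [])     _   = [] ∷ []
  increasingV⇒Increasing (t ∷ u ∷ us) inc with increasingV⇒Increasing (u ∷ us) (∧-trueʳ inc)
  ... | u< ∷ inc′ = (t<u ∷ All.map (<-trans t<u) u<) ∷ u< ∷ inc′
    where t<u = <ᵇ≡true⇒< (∧-trueˡ inc)

  Increasing⇒increasingV : ∀ {ts : Vec DTree n} → Increasing ts → increasingV ts ≡ true
  Increasing⇒increasingV []                  = refl
  Increasing⇒increasingV ([] ∷ [])           = refl
  Increasing⇒increasingV ((t<u ∷ _) ∷ inc) = ∧-true (<⇒<ᵇ≡true t<u) (Increasing⇒increasingV inc)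

  node-wellFormed⁻ : ∀ ℓ (cs : Vec DTree d) → WellFormed (node d ℓ cs) → Increasing cs × All WellFormed cs
  node-wellFormed⁻ _ cs wf = increasingV⇒Increasing cs (∧-trueˡ wf) , wellFormedV⇒All cs (∧-trueʳ wf)

  node-wellFormed⁺ : ∀ ℓ (cs : Vec DTree d) → Increasing cs → All WellFormed cs → WellFormed (node d ℓ cs)
  node-wellFormed⁺ _ _ inc wfs = ∧-true (Increasing⇒increasingV inc) (All⇒wellFormedV wfs)

  -- The side conditions are irrelevant, so that a forest is determined by its trees.
  record Forest (a n j : ℕ) : Set where
    constructor forest
    field
      trees       : Vec DTree j
      .allWF      : All WellFormed trees
      .increasing : Increasing trees
      .labelling  : leavesV trees ↭ range a n

  forest-cong : ∀ {ts ts′ : Vec DTree j} .{w i l w′ i′ l′} → ts ≡ ts′ →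
                forest {a} {n} ts w i l ≡ forest ts′ w′ i′ l′
  forest-cong refl = refl

  Forest-cong : ∀ {n n′} → n ≡ n′ → Forest a n j ↔ Forest a n′ j
  Forest-cong refl = ↔-refl

  Forest-empty↔Fin1 : Forest a 0 0 ↔ Fin 1
  Forest-empty↔Fin1 = mk↔ₛ′ (λ _ → Fin.zero) (λ _ → forest [] [] [] ↭-refl)
                    (λ { Fin.zero → refl ; (Fin.suc ()) }) (λ { (forest [] _ _ _) → refl })

  Forest-no-trees : Forest a (suc n) 0 → ⊥
  Forest-no-trees (forest [] _ _ p) = Irrelevant.⊥-elim (noLabels p)
    where
    noLabels : [] ↭ range a (suc n) → ⊥
    noLabels p with ↭-length p
    ... | ()

  Forest-trees≤labels : Forest a n j → j ≤ n
  Forest-trees≤labels {a} {n} {j} (forest ts _ _ p) =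
    recompute (j ≤? n) (≤-trans (trees≤leaves ts) (≤-reflexive (trans (↭-length p) (range-length a n))))
    where
    trees≤leaves : ∀ {j} (ts : Vec DTree j) → j ≤ length (leavesV ts)
    trees≤leaves []       = z≤n
    trees≤leaves (t ∷ ts) = subst (suc _ ≤_) (sym (length-++ (leaves t)))
                              (+-mono-≤ (nonempty (proj₂ (leaves-nonempty t))) (trees≤leaves ts))
      where nonempty : ∀ {y} {xs : List ℕ} → y ∈ xs → 1 ≤ length xs
            nonempty (here _)  = s≤s z≤n
            nonempty (there _) = s≤s z≤n

  -- The first tree is an internal vertex: its label, and the forest in which
  -- its children take its place, the last d - 1 of them shuffled in key order
  -- among the remaining j trees.
  Unfolded : ℕ → ℕ → ℕ → Set
  Unfolded a n j = Fin (X d) × Shuffle (suc e) j (suc e + j) × Forest a (suc n) (suc (suc e + j))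

  module _ (ℓ : Fin (X d)) (c : DTree) (cs : Vec DTree (suc e)) (rest : Vec DTree j) where
    private
      σ = sortingShuffle key cs rest refl

    unfold-allWF : All WellFormed (node d ℓ (c ∷ cs) ∷ rest) → All WellFormed (c ∷ merge σ cs rest)
    unfold-allWF (wf ∷ wfs) with node-wellFormed⁻ ℓ (c ∷ cs) wf
    ... | _ , wfc ∷ wfcs = wfc ∷ All-merge⁺ σ wfcs wfs

    unfold-increasing : All WellFormed (node d ℓ (c ∷ cs) ∷ rest) → Increasing (node d ℓ (c ∷ cs) ∷ rest) →
      leavesV (node d ℓ (c ∷ cs) ∷ rest) ↭ range a n → Increasing (c ∷ merge σ cs rest)
    unfold-increasing {a} {n} (wf ∷ _) (node< ∷ inc) p with node-wellFormed⁻ ℓ (c ∷ cs) wf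
    ... | c< ∷ incs , _ =
      All-merge⁺ σ c< c<rest ∷ sortingShuffle-sorted key cs rest refl incs inc distinct
      where
      c<rest : All (λ u → key c < key u) rest
      c<rest = subst (λ k → All (λ u → k < key u) rest) (key-node ℓ c cs (c< ∷ incs)) node<
      disjoint : Disjoint (leavesV (c ∷ cs)) (leavesV rest)
      disjoint = Unique-++⇒Disjoint (leavesV (c ∷ cs)) (Unique-resp-↭ (↭-sym p) (range-unique a n))
      distinct : Distinct key cs rest
      distinct = All.map (λ x∈ → All.map (λ y∈ x≡y → disjoint (x∈ , subst (_∈ leavesV rest) (sym x≡y) y∈))
                                         (key∈leavesV rest))
                         (All.tail (key∈leavesV (c ∷ cs)))

  module _ (ℓ : Fin (X d)) (σ : Shuffle (suc e) j (suc e + j)) (g : DTree) (gs : Vec DTree (suc e + j)) where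

    fold-allWF : All WellFormed (g ∷ gs) → Increasing (g ∷ gs) →
      All WellFormed (node d ℓ (g ∷ unmergeˡ σ gs) ∷ unmergeʳ σ gs)
    fold-allWF (wfg ∷ wfgs) (g< ∷ inc) =
      node-wellFormed⁺ ℓ (g ∷ unmergeˡ σ gs) (All-unmergeˡ σ g< ∷ AllPairs-unmergeˡ σ inc)
                                              (wfg ∷ All-unmergeˡ σ wfgs)
      ∷ All-unmergeʳ σ wfgs

    fold-increasing : Increasing (g ∷ gs) → Increasing (node d ℓ (g ∷ unmergeˡ σ gs) ∷ unmergeʳ σ gs)
    fold-increasing (g< ∷ inc) =
      subst (λ k → All (λ u → k < key u) (unmergeʳ σ gs))
            (sym (key-node ℓ g (unmergeˡ σ gs) (All-unmergeˡ σ g< ∷ AllPairs-unmergeˡ σ inc)))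
            (All-unmergeʳ σ g<)
      ∷ AllPairs-unmergeʳ σ inc

    fold-labelling : ∀ {r} → leavesV (g ∷ gs) ↭ r →
                     leavesV (node d ℓ (g ∷ unmergeˡ σ gs) ∷ unmergeʳ σ gs) ↭ r
    fold-labelling p = ↭-trans (↭-sym (leavesV-unfold ℓ g (unmergeˡ σ gs) (unmergeʳ σ gs) σ))
                               (subst (λ zs → leavesV (g ∷ zs) ↭ _) (sym (merge-unmerge σ gs)) p)

  unfold : ∀ k (ℓ : Fin (X k)) (cs : Vec DTree k) (rest : Vec DTree j) → k ≡ d →
    .(All WellFormed (node k ℓ cs ∷ rest)) → .(Increasing (node k ℓ cs ∷ rest)) →
    .(leavesV (node k ℓ cs ∷ rest) ↭ range a (suc n)) → Unfolded a n j
  unfold _ ℓ (c ∷ cs) rest refl wf inc p =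
    ℓ , σ , forest (c ∷ merge σ cs rest) (unfold-allWF ℓ c cs rest wf)
                   (unfold-increasing ℓ c cs rest wf inc p) (↭-trans (leavesV-unfold ℓ c cs rest σ) p)
    where σ = sortingShuffle key cs rest refl

  fold : Unfolded a n j → Forest a (suc n) (suc j)
  fold (ℓ , σ , forest (g ∷ gs) wf inc p) =
    forest (node d ℓ (g ∷ unmergeˡ σ gs) ∷ unmergeʳ σ gs)
           (fold-allWF ℓ σ g gs wf inc) (fold-increasing ℓ σ g gs inc) (fold-labelling ℓ σ g gs p)

  fold∘unfold : ∀ k (ℓ : Fin (X k)) (cs : Vec DTree k) (rest : Vec DTree j) (k≡d : k ≡ d) .wf .inc .p →
    fold (unfold {a = a} {n} k ℓ cs rest k≡d wf inc p) ≡ forest (node k ℓ cs ∷ rest) wf inc p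
  fold∘unfold _ ℓ (c ∷ cs) rest refl _ _ _ =
    forest-cong (cong₂ (λ xs ys → node d ℓ (c ∷ xs) ∷ ys)
                       (unmergeˡ-merge σ cs rest) (unmergeʳ-merge σ cs rest))
    where σ = sortingShuffle key cs rest refl

  -- The arity proof is kept abstract: arity ℓ does not compute to refl.
  unfold∘fold : ∀ ℓ (σ : Shuffle (suc e) j (suc e + j)) g gs (q : d ≡ d) .wf .inc .p .wf′ .inc′ .p′ →
    Increasing (g ∷ gs) →
    unfold {a = a} {n} d ℓ (g ∷ unmergeˡ σ gs) (unmergeʳ σ gs) q wf inc p
      ≡ (ℓ , σ , forest (g ∷ gs) wf′ inc′ p′)
  unfold∘fold ℓ σ g gs q _ _ _ _ _ _ (_ ∷ inc) with ≡-irrelevant q refl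
  ... | refl = cong (ℓ ,_) (cong₂ _,_ τ≡σ (forest-cong (cong (g ∷_)
                 (trans (cong (λ τ → merge τ (unmergeˡ σ gs) (unmergeʳ σ gs)) τ≡σ) (merge-unmerge σ gs)))))
    where
    τ≡σ : sortingShuffle key (unmergeˡ σ gs) (unmergeʳ σ gs) refl ≡ σ
    τ≡σ = sortingShuffle-unique key σ _ _ refl (subst Increasing (sym (merge-unmerge σ gs)) inc)

  leaf-first : ∀ {i} (rest : Vec DTree j) → Increasing (leaf i ∷ rest) →
               leavesV (leaf i ∷ rest) ↭ range a (suc n) → a ≡ i
  leaf-first {i = i} rest inc p with min∈head (leaf i) rest inc p
  ... | here a≡i = a≡i

  split : Forest a (suc n) (suc j) → Forest (suc a) n j ⊎ Unfolded a n j
  split (forest (leaf i ∷ rest) wf inc p) =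
    inj₁ (forest rest (All.tail wf) (AllPairs.tail inc)
                 (drop-∷ (subst (λ k → k ∷ leavesV rest ↭ _) (sym (leaf-first rest inc p)) p)))
  split (forest (node k ℓ cs ∷ rest) wf inc p) = inj₂ (unfold k ℓ cs rest (arity ℓ) wf inc p)

  unsplit : Forest (suc a) n j ⊎ Unfolded a n j → Forest a (suc n) (suc j)
  unsplit {a} (inj₁ (forest rest wf inc p)) =
    forest (leaf a ∷ rest) (refl ∷ wf) (labels≤keys p ∷ inc) (↭-prep a p)
  unsplit (inj₂ x) = fold x

  unsplit∘split : ∀ (F : Forest a (suc n) (suc j)) → unsplit (split F) ≡ F
  unsplit∘split {a} (forest (leaf i ∷ rest) wf inc p) =
    forest-cong (cong (λ k → leaf k ∷ rest) (recompute (a ≟ i) (leaf-first rest inc p)))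
  unsplit∘split (forest (node k ℓ cs ∷ rest) wf inc p) = fold∘unfold k ℓ cs rest (arity ℓ) wf inc p

  split∘unsplit : ∀ (x : Forest (suc a) n j ⊎ Unfolded a n j) → split (unsplit x) ≡ x
  split∘unsplit (inj₁ _) = refl
  split∘unsplit (inj₂ (ℓ , σ , forest (g ∷ gs) wf inc p)) =
    cong inj₂ (unfold∘fold ℓ σ g gs (arity ℓ) _ _ _ _ _ _
                           (recompute (allPairs? (λ x y → key x <? key y) (g ∷ gs)) inc))

  Forest-split : Forest a (suc n) (suc j) ↔ (Forest (suc a) n j ⊎ Unfolded a n j)
  Forest-split = mk↔ₛ′ split unsplit split∘unsplit unsplit∘split

  -- A forest with i internal vertices and j trees has i (d - 1) + j leaves.
  mutual
    Forest↔Fin : ∀ i j a → Forest a (i * suc e + j) j ↔ Fin (forestCount i j)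
    Forest↔Fin i (suc j) a =
      ↔-trans (Forest-cong (+-suc (i * suc e) j))
      (↔-trans Forest-split
      (↔-trans (Forest↔Fin i j (suc a) ⊎-↔ Unfolded↔Fin i j a) (↔-sym +↔⊎)))
    Forest↔Fin zero    zero a = Forest-empty↔Fin1
    Forest↔Fin (suc i) zero a = empty↔Fin0 Forest-no-trees

    Unfolded↔Fin : ∀ i j a → Unfolded a (i * suc e + j) j ↔ Fin (unfoldedCount i j)
    Unfolded↔Fin zero j a = empty↔Fin0 λ (_ , _ , F) → ≤⇒≯ (s≤s⁻¹ (Forest-trees≤labels F)) (m<n+m j z<s)
    Unfolded↔Fin (suc i) j a =
      ↔-trans (Fin-Xd↔Fin-m ×-↔ (Shuffle↔Fin (suc e) j (suc e + j)
                                ×-↔ ↔-trans (Forest-cong size) (Forest↔Fin i (suc (suc e + j)) a)))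
              (↔-sym (↔-trans *↔× (↔-refl ×-↔ *↔×)))
      where
      size : suc (suc i * suc e + j) ≡ i * suc e + suc (suc e + j)
      size = lemma i j e
        where lemma : ∀ i j e → suc (suc i * suc e + j) ≡ i * suc e + suc (suc e + j)
              lemma = solve-∀

  LT↔Forest : ∀ l → LT X l ↔ Forest 1 l 1
  LT↔Forest l = mk↔ₛ′ to from (λ { (forest (_ ∷ []) _ _ _) → refl })
                              (λ (t , _) → cong (t ,_) (Decidable⇒UIP.≡-irrelevant Bool._≟_ _ _))
    where
    isLT⇔ : ∀ (t : DTree) → isLT l t ≡ true ⇔ (WellFormed t × leavesV (t ∷ []) ↭ range 1 l)
    isLT⇔ t = mk⇔
      (λ q → let wf , bij = Equivalence.to Bool.T-∧ (Equivalence.from Bool.T-≡ q)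
             in Equivalence.to Bool.T-≡ wf
              , ↭-trans (↭-reflexive (++-identityʳ (leaves t))) (Equivalence.to (leavesBijective⇔↭ l t) bij))
      (λ (wf , p) → Equivalence.to Bool.T-≡ (Equivalence.from Bool.T-∧
              ( Equivalence.from Bool.T-≡ wf
              , Equivalence.from (leavesBijective⇔↭ l t)
                                 (↭-trans (↭-reflexive (sym (++-identityʳ (leaves t)))) p))))
    to : LT X l → Forest 1 l 1
    to (t , q) = let wf , p = Equivalence.to (isLT⇔ t) q in forest (t ∷ []) (wf ∷ []) ([] ∷ []) p
    from : Forest 1 l 1 → LT X l
    from (forest (t ∷ []) wf _ p) =
      t , recompute (isLT l t Bool.≟ true) (Equivalence.from (isLT⇔ t) (All.head wf , p))

mainTheorem1 : (d m : ℕ) → 2 ≤ d → 1 ≤ m → (k : ℕ) →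
    Σ ℕ (λ N → (LT (concentrated d m) (k * d ∸ k + 1) ↔ Fin N)
    × (N * ((d !) ^ k * k !) ≡ m ^ k * (k * d) !))
mainTheorem1 (suc (suc e)) m (s≤s (s≤s z≤n)) _ k =
  forestCount k 1 ,
  ↔-trans (LT↔Forest (k * d ∸ k + 1)) (↔-trans (Forest-cong leaves≡) (Forest↔Fin k 1 1)) ,
  forestCount-one k
  where
  open Counting e m
  open DAryForests e m
  leaves≡ : k * d ∸ k + 1 ≡ k * suc e + 1
  leaves≡ = cong (_+ 1) (trans (cong (_∸ k) (*-suc k (suc e))) (m+n∸m≡n k (k * suc e)))
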